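{- For $s\in\mathbb{N}$ let $x_s(k)=2(2k+3)^s$ and $$L^{\ast}(x_s(k))=(k+1)^3x_s(k)-(2k+1)(17k^2+17k+5)x_s(k-1)+k^3x_s(k-2).$$ Then $$L^\ast(x_s(k))=-8(2k+1)^{s+3}+\sum_{j=1}^{\lfloor (s+3)/2\rfloor}e_j(2k+1)^{s+3-2j}$$ for some integers $e_j\in\mathbb{Z}$, $j=1,2,\ldots,\lfloor (s+3)/2\rfloor$.
   Context: Here $L^{\ast}$ is the adjoint $L^{\ast}(x(k))=\sum_{i=0}^2a_i(k-i)x(k-i)$ of the operator $L=(k+2)^3\sigma^2-(2k+3)(17k^2+51k+39)\sigma+(k+1)^3$ annihilating the Apéry numbers; $\mathbb{N}=\{0,1,2,\dots\}$. -}

module Defs where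

open import Data.Nat as ℕ using (ℕ; zero; suc; _∸_; _/_)
open import Data.Integer using (ℤ; +_; _+_; _-_; _*_; -_; _^_)

xs : ℕ → ℤ → ℤ
xs s k = + 2 * ((+ 2 * k + + 3) ^ s)

Lstar : (ℤ → ℤ) → ℤ → ℤ
Lstar x k = ((k + + 1) ^ 3) * x k
          - (+ 2 * k + + 1) * (+ 17 * (k ^ 2) + + 17 * k + + 5) * x (k - + 1)
          + (k ^ 3) * x (k - + 2)

sumFrom1 : ℕ → (ℕ → ℤ) → ℤ
sumFrom1 zero    f = + 0
sumFrom1 (suc m) f = sumFrom1 m f + f (suc m)

module Submission where

open import Defs
open import Data.Nat using (ℕ; _∸_; _/_)
open import Data.Integer using (ℤ; +_; _+_; _*_; -_; _^_)
open import Data.Product using (∃)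
open import Relation.Binary.PropositionalEquality using (_≡_)

open import Data.Nat as ℕ using (zero; suc; s≤s; z≤n)
open import Data.Nat.Properties using (+-comm; *-suc)
open import Data.Nat.DivMod using (m/n≡1+[m∸n]/n)
open import Data.Integer using (_-_)
open import Data.Integer.Properties using (+-identityˡ; +-identityʳ; *-zeroˡ; *-zeroʳ)
open import Data.Integer.Tactic.RingSolver using (solve-∀)
open import Data.Product using (_,_)
open import Relation.Binary.PropositionalEquality
  using (refl; sym; trans; cong; cong₂; module ≡-Reasoning)

-- Put u = 2k + 1, so that x_s(k), x_s(k-1), x_s(k-2) are 2(u+2)^s, 2u^s, 2(u-2)^s and
-- 8(k+1)^3, 8k^3 and 4(2k+1)(17k^2+17k+5) are (u+1)^3, (u-1)^3 and u(17u^2+3).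
-- Split (u ± 2)^s = u^s + 4a(u) ± 2b(u), where 4a collects the binomial terms with an even
-- power of 2 and 2b those with an odd power; a is a combination of u^(s-2), u^(s-4), … and
-- b one of u^(s-1), u^(s-3), …  In L* the u^s terms add up to -8u^(s+3), and what remains,
-- 2u^3 a + 6u a + 3u^2 b + b, is a combination of u^(s+1), u^(s-1), …

-- Tail n f : f is an integer combination of the monomials u^(n ∸ 2j), 1 ≤ j ≤ n / 2.
data Tail : ℕ → (ℤ → ℤ) → Set where
  vanishing : ∀ {n f} → (∀ u → f u ≡ + 0) → Tail n f
  extend    : ∀ {n f g} (c : ℤ) → Tail n g → (∀ u → f u ≡ c * u ^ n + g u) →
              Tail (suc (suc n)) f

Tail-resp : ∀ {n f g} → Tail n f → (∀ u → g u ≡ f u) → Tail n g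
Tail-resp (vanishing f≡0)  g≡f = vanishing (λ u → trans (g≡f u) (f≡0 u))
Tail-resp (extend c t f≡)  g≡f = extend c t (λ u → trans (g≡f u) (f≡ u))

Tail-+ : ∀ {n f g} → Tail n f → Tail n g → Tail n (λ u → f u + g u)
Tail-+ {g = g} (vanishing f≡0) tg =
  Tail-resp tg (λ u → trans (cong (_+ g u) (f≡0 u)) (+-identityˡ (g u)))
Tail-+ {f = f} tf (vanishing g≡0) =
  Tail-resp tf (λ u → trans (cong (_+_ (f u)) (g≡0 u)) (+-identityʳ (f u)))
Tail-+ {suc (suc n)} (extend c tf f≡) (extend d tg g≡) =
  extend (c + d) (Tail-+ tf tg)
    (λ u → trans (cong₂ _+_ (f≡ u) (g≡ u)) (interchange c d (u ^ n) _ _))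
  where
  interchange : ∀ c d x y z → (c * x + y) + (d * x + z) ≡ (c + d) * x + (y + z)
  interchange = solve-∀

Tail-scale : ∀ {n f} (d : ℤ) → Tail n f → Tail n (λ u → d * f u)
Tail-scale d (vanishing f≡0) = vanishing (λ u → trans (cong (d *_) (f≡0 u)) (*-zeroʳ d))
Tail-scale {suc (suc n)} d (extend c t f≡) =
  extend (d * c) (Tail-scale d t) (λ u → trans (cong (d *_) (f≡ u)) (distrib d c (u ^ n) _))
  where
  distrib : ∀ d c x y → d * (c * x + y) ≡ d * c * x + d * y
  distrib = solve-∀

Tail-*u : ∀ {n f} → Tail n f → Tail (suc n) (λ u → u * f u)
Tail-*u (vanishing f≡0) = vanishing (λ u → trans (cong (u *_) (f≡0 u)) (*-zeroʳ u))
Tail-*u {suc (suc n)} (extend c t f≡) =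
  extend c (Tail-*u t) (λ u → trans (cong (u *_) (f≡ u)) (distrib u c (u ^ n) _))
  where
  distrib : ∀ u c x y → u * (c * x + y) ≡ c * (u * x) + u * y
  distrib = solve-∀

Tail-raise : ∀ {n f} → Tail n f → Tail (suc (suc n)) f
Tail-raise {n} t = extend (+ 0) t (λ u → add-zero (u ^ n) _)
  where
  add-zero : ∀ x y → y ≡ + 0 * x + y
  add-zero = solve-∀

Tail-monomial : ∀ n → Tail (suc (suc n)) (_^ n)
Tail-monomial n = extend (+ 1) (vanishing (λ _ → refl)) (λ u → unit (u ^ n))
  where
  unit : ∀ x → x ≡ + 1 * x + + 0
  unit = solve-∀

sumFrom1-cong : ∀ m {f g : ℕ → ℤ} → (∀ j → f (suc j) ≡ g (suc j)) →
                sumFrom1 m f ≡ sumFrom1 m g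
sumFrom1-cong zero    f≡g = refl
sumFrom1-cong (suc m) f≡g = cong₂ _+_ (sumFrom1-cong m f≡g) (f≡g m)

sumFrom1-zero : ∀ m (f : ℕ → ℤ) → sumFrom1 m (λ j → + 0 * f j) ≡ + 0
sumFrom1-zero zero    f = refl
sumFrom1-zero (suc m) f = cong₂ _+_ (sumFrom1-zero m f) (*-zeroˡ (f (suc m)))

sumFrom1-unfoldˡ : ∀ m (f : ℕ → ℤ) → sumFrom1 (suc m) f ≡ f 1 + sumFrom1 m (λ j → f (suc j))
sumFrom1-unfoldˡ zero    f = trans (+-identityˡ (f 1)) (sym (+-identityʳ (f 1)))
sumFrom1-unfoldˡ (suc m) f =
  trans (cong (_+ f (suc (suc m))) (sumFrom1-unfoldˡ m f))
        (reassoc (f 1) (sumFrom1 m (λ j → f (suc j))) (f (suc (suc m))))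
  where
  reassoc : ∀ a b c → a + b + c ≡ a + (b + c)
  reassoc = solve-∀

Tail-sum : ∀ {n f} → Tail n f →
           ∃ λ (e : ℕ → ℤ) → ∀ u → f u ≡ sumFrom1 (n / 2) (λ j → e j * u ^ (n ∸ 2 ℕ.* j))
Tail-sum {n} (vanishing f≡0) =
  (λ _ → + 0) , λ u → trans (f≡0 u) (sym (sumFrom1-zero (n / 2) (λ j → u ^ (n ∸ 2 ℕ.* j))))
Tail-sum {suc (suc n)} {f} (extend {g = g} c t f≡) with Tail-sum t
... | e , g≡sum = e′ , f≡sum
  where
  open ≡-Reasoning
  e′ : ℕ → ℤ
  e′ zero          = + 0
  e′ (suc zero)    = c
  e′ (suc (suc j)) = e (suc j)
  f≡sum : ∀ u → f u ≡ sumFrom1 (suc (suc n) / 2) (λ j → e′ j * u ^ (suc (suc n) ∸ 2 ℕ.* j))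
  f≡sum u = begin
      f u
    ≡⟨ f≡ u ⟩
      c * u ^ n + g u
    ≡⟨ cong (_+_ (c * u ^ n)) (g≡sum u) ⟩
      c * u ^ n + sumFrom1 (n / 2) (λ j → e j * u ^ (n ∸ 2 ℕ.* j))
    ≡⟨ cong (_+_ (c * u ^ n)) (sumFrom1-cong (n / 2) (λ j →
         cong (λ i → e (suc j) * u ^ (suc (suc n) ∸ i)) (sym (*-suc 2 (suc j))))) ⟩
      c * u ^ n + sumFrom1 (n / 2) (λ j → term (suc j))
    ≡⟨ sumFrom1-unfoldˡ (n / 2) term ⟨
      sumFrom1 (suc (n / 2)) term
    ≡⟨ cong (λ m → sumFrom1 m term) (m/n≡1+[m∸n]/n {suc (suc n)} (s≤s (s≤s z≤n))) ⟨
      sumFrom1 (suc (suc n) / 2) term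
    ∎
    where
    term : ℕ → ℤ
    term j = e′ j * u ^ (suc (suc n) ∸ 2 ℕ.* j)

record BinomialSplit (s : ℕ) : Set where
  field
    even odd  : ℤ → ℤ
    even-tail : Tail s even
    odd-tail  : Tail (suc s) odd
    shift⁺    : ∀ u → (u + + 2) ^ s ≡ u ^ s + + 4 * even u + + 2 * odd u
    shift⁻    : ∀ u → (u - + 2) ^ s ≡ u ^ s + + 4 * even u - + 2 * odd u

binomial-split : ∀ s → BinomialSplit s
binomial-split zero = record
  { even = λ _ → + 0 ; odd = λ _ → + 0
  ; even-tail = vanishing (λ _ → refl) ; odd-tail = vanishing (λ _ → refl)
  ; shift⁺ = λ _ → refl ; shift⁻ = λ _ → refl
  }
binomial-split (suc s) = record
  { even      = λ u → u * even u + odd u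
  ; odd       = λ u → u * odd u + u ^ s + + 4 * even u
  ; even-tail = Tail-+ (Tail-*u even-tail) odd-tail
  ; odd-tail  = Tail-+ (Tail-+ (Tail-*u odd-tail) (Tail-monomial s))
                       (Tail-scale (+ 4) (Tail-raise even-tail))
  ; shift⁺    = λ u → trans (cong ((u + + 2) *_) (shift⁺ u)) (step⁺ u (u ^ s) (even u) (odd u))
  ; shift⁻    = λ u → trans (cong ((u - + 2) *_) (shift⁻ u)) (step⁻ u (u ^ s) (even u) (odd u))
  }
  where
  open BinomialSplit (binomial-split s)
  step⁺ : ∀ u p a b → (u + + 2) * (p + + 4 * a + + 2 * b)
                    ≡ u * p + + 4 * (u * a + b) + + 2 * (u * b + p + + 4 * a)
  step⁺ = solve-∀
  step⁻ : ∀ u p a b → (u - + 2) * (p + + 4 * a - + 2 * b)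
                    ≡ u * p + + 4 * (u * a + b) - + 2 * (u * b + p + + 4 * a)
  step⁻ = solve-∀

correction : (ℤ → ℤ) → (ℤ → ℤ) → ℤ → ℤ
correction a b u = + 2 * (u * (u * (u * a u))) + + 6 * (u * a u) + + 3 * (u * (u * b u)) + b u

Tail-correction : ∀ {s a b} → Tail s a → Tail (suc s) b → Tail (3 ℕ.+ s) (correction a b)
Tail-correction ta tb =
  Tail-+ (Tail-+ (Tail-+ (Tail-scale (+ 2) (Tail-*u (Tail-*u (Tail-*u ta))))
                         (Tail-scale (+ 6) (Tail-raise (Tail-*u ta))))
                 (Tail-scale (+ 3) (Tail-*u (Tail-*u tb))))
         (Tail-raise tb)

2k+3≡[2k+1]+2 : ∀ k → + 2 * k + + 3 ≡ (+ 2 * k + + 1) + + 2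
2k+3≡[2k+1]+2 = solve-∀

2[k-1]+3≡2k+1 : ∀ k → + 2 * (k - + 1) + + 3 ≡ + 2 * k + + 1
2[k-1]+3≡2k+1 = solve-∀

2[k-2]+3≡[2k+1]-2 : ∀ k → + 2 * (k - + 2) + + 3 ≡ (+ 2 * k + + 1) - + 2
2[k-2]+3≡[2k+1]-2 = solve-∀

-- The integer powers are written out in their normal form k * (… * (k * + 1)),
-- because the ring solver does not interpret Data.Integer._^_.
Lstar-split-identity : ∀ k p a b →
    (k + + 1) * ((k + + 1) * ((k + + 1) * + 1)) * (+ 2 * (p + + 4 * a + + 2 * b))
      - (+ 2 * k + + 1) * (+ 17 * (k * (k * + 1)) + + 17 * k + + 5) * (+ 2 * p)
      + k * (k * (k * + 1)) * (+ 2 * (p + + 4 * a - + 2 * b))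
  ≡ - (+ 8 * ((+ 2 * k + + 1) * ((+ 2 * k + + 1) * ((+ 2 * k + + 1) * p))))
    + (+ 2 * ((+ 2 * k + + 1) * ((+ 2 * k + + 1) * ((+ 2 * k + + 1) * a)))
       + + 6 * ((+ 2 * k + + 1) * a)
       + + 3 * ((+ 2 * k + + 1) * ((+ 2 * k + + 1) * b)) + b)
Lstar-split-identity = solve-∀

Lstar-xs : ∀ s k → let u = + 2 * k + + 1; open BinomialSplit (binomial-split s) in
           Lstar (xs s) k ≡ - (+ 8 * u ^ (3 ℕ.+ s)) + correction even odd u
Lstar-xs s k = begin
    Lstar (xs s) k
  ≡⟨ cong₂ (λ P M → L P (+ 2 * (k - + 1) + + 3) M)
           (2k+3≡[2k+1]+2 k) (2[k-2]+3≡[2k+1]-2 k) ⟩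
    L (u + + 2) (+ 2 * (k - + 1) + + 3) (u - + 2)
  ≡⟨ cong (λ p → L (u + + 2) p (u - + 2)) (2[k-1]+3≡2k+1 k) ⟩
    L (u + + 2) u (u - + 2)
  ≡⟨ cong₂ (λ P M → ℓ P (u ^ s) M) (shift⁺ u) (shift⁻ u) ⟩
    ℓ (u ^ s + + 4 * even u + + 2 * odd u) (u ^ s) (u ^ s + + 4 * even u - + 2 * odd u)
  ≡⟨ Lstar-split-identity k (u ^ s) (even u) (odd u) ⟩
    - (+ 8 * u ^ (3 ℕ.+ s)) + correction even odd u
  ∎
  where
  open ≡-Reasoning
  open BinomialSplit (binomial-split s)
  u : ℤ
  u = + 2 * k + + 1
  ℓ : ℤ → ℤ → ℤ → ℤ
  ℓ y₀ y₁ y₂ = (k + + 1) ^ 3 * (+ 2 * y₀)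
               - (+ 2 * k + + 1) * (+ 17 * k ^ 2 + + 17 * k + + 5) * (+ 2 * y₁)
               + k ^ 3 * (+ 2 * y₂)
  L : ℤ → ℤ → ℤ → ℤ
  L b₀ b₁ b₂ = ℓ (b₀ ^ s) (b₁ ^ s) (b₂ ^ s)

lemma3p5 : (s : ℕ) → ∃ λ (e : ℕ → ℤ) → (k : ℤ) →
    Lstar (xs s) k
      ≡ - (+ 8 * ((+ 2 * k + + 1) ^ (s Data.Nat.+ 3)))
        + sumFrom1 ((s Data.Nat.+ 3) / 2)
            (λ j → e j * ((+ 2 * k + + 1) ^ ((s Data.Nat.+ 3) ∸ (2 Data.Nat.* j))))
lemma3p5 s rewrite +-comm s 3 with Tail-sum (Tail-correction even-tail odd-tail)
  where open BinomialSplit (binomial-split s)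
... | e , correction≡sum =
  e , λ k → let u = + 2 * k + + 1 in
    trans (Lstar-xs s k) (cong (_+_ (- (+ 8 * u ^ (3 ℕ.+ s)))) (correction≡sum u))
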